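{- Let $N$ be a positive integer, let $K_{N^2}$ be the complete graph on $N^2$ nodes, and let $a,b,c$ be three distinct nodes of $K_{N^2}$. For every edge-colouring $C:E(K_{N^2})\to[N]$ with $C(\{a,b\})\neq C(\{a,c\})$, there exist three distinct nodes $x,y,z$ forming a bichromatic triangle (i.e., the three edges of $\{x,y,z\}$ receive exactly two distinct colours) such that $\{a,b,c\}\cap\{x,y,z\}\neq\emptyset$.
   Context: $[N]=\{1,\dots,N\}$. -}

module Defs where

open import Data.Nat using (ℕ; _*_)
open import Data.Fin using (Fin)
open import Data.Product using (_×_; Σ-syntax)
open import Data.Sum using (_⊎_)
open import Relation.Binary.PropositionalEquality using (_≡_; _≢_)

-- An edge-colouring of K_n with colours [k] (represented as Fin k) assigns a colour
-- to each unordered pair {u,v} with u ≠ v. We represent it as a function on ordered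
-- pairs that is symmetric on distinct pairs; values on the diagonal are irrelevant.
record EdgeColouring (n k : ℕ) : Set where
  field
    colour    : Fin n → Fin n → Fin k
    symmetric : ∀ u v → u ≢ v → colour u v ≡ colour v u
open EdgeColouring public

ExactlyTwoDistinct : {A : Set} → A → A → A → Set
ExactlyTwoDistinct p q r =
    (p ≡ q × q ≢ r)
  ⊎ (p ≡ r × p ≢ q)
  ⊎ (q ≡ r × p ≢ q)

BichromaticTriangle : ∀ {n k} → EdgeColouring n k → Fin n → Fin n → Fin n → Set
BichromaticTriangle C x y z =
  x ≢ y × y ≢ z × x ≢ z ×
  ExactlyTwoDistinct (colour C x y) (colour C y z) (colour C x z)

Meets : ∀ {n} → Fin n → Fin n → Fin n → Fin n → Fin n → Fin n → Set
Meets a b c x y z = Σ[ w ∈ _ ] ((w ≡ a ⊎ w ≡ b ⊎ w ≡ c) × (w ≡ x ⊎ w ≡ y ⊎ w ≡ z))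

{-# OPTIONS --safe #-}
-- Suppose no bichromatic triangle passes through a, b or c, so every triangle through one of
-- them is monochromatic or rainbow; write α, β, γ for the colours of ab, ac, bc, so that abc is
-- rainbow. Send a vertex v ∉ {a, b} to (C(a,v), C(b,v)) if these colours differ. Otherwise
-- triangle abv is monochromatic, and v goes to the diagonal pair (δ, δ) with δ = C(c,v); a and b
-- go to (α, α) and (β, β). Comparing triangles through a, b and c shows that this map from the N²
-- vertices to the N² pairs of colours is injective and misses (γ, γ), against the pigeonhole
-- principle.
module Submission where

open import Defs
open import Data.Nat using (ℕ; suc; _*_; NonZero)
open import Data.Nat.Properties using (n<1+n)
open import Data.Fin using (Fin; _≟_; combine; punchOut)
open import Data.Fin.Properties using (any?; pigeonhole; combine-injective; punchOut-injective; <⇒≢)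
open import Data.Product using (_×_; Σ-syntax; _,_; proj₁; proj₂)
open import Data.Product.Properties using (,-injectiveˡ; ,-injectiveʳ; ×-≡,≡→≡)
open import Data.Sum using (inj₁; inj₂)
open import Data.Empty using (⊥; ⊥-elim)
open import Function using (_∘_)
open import Relation.Nullary using (¬_; Dec; yes; no)
open import Relation.Nullary.Decidable using (_×-dec_; _⊎-dec_; ¬?)
open import Relation.Binary.Definitions using (DecidableEquality)
open import Relation.Binary.PropositionalEquality
  using (_≡_; _≢_; refl; sym; trans; ≢-sym)

injection-cannot-avoid : ∀ {m n} (f : Fin (m * n) → Fin m × Fin n) →
                         (∀ {i j} → i ≢ j → f i ≢ f j) → ∀ p → ¬ (∀ i → f i ≢ p)
injection-cannot-avoid {suc _} {suc _} f f-inj (x , y) f≢p = collision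
  where
    combine≢ : ∀ i → combine x y ≢ combine (proj₁ (f i)) (proj₂ (f i))
    combine≢ i e = f≢p i (sym (×-≡,≡→≡ (combine-injective _ _ _ _ e)))

    collision : ⊥
    collision with i , j , i<j , e ← pigeonhole (n<1+n _) (λ i → punchOut (combine≢ i))
      = f-inj (<⇒≢ i<j)
          (×-≡,≡→≡ (combine-injective _ _ _ _ (punchOut-injective (combine≢ i) (combine≢ j) e)))

module _ {A : Set} {p q r : A} (¬two : ¬ ExactlyTwoDistinct p q r) where

  ¬exactlyTwo-rainbow : p ≢ r → q ≢ p × q ≢ r
  ¬exactlyTwo-rainbow p≢r =
      (λ q≡p → ¬two (inj₁ (sym q≡p , λ q≡r → p≢r (trans (sym q≡p) q≡r))))
    , (λ q≡r → ¬two (inj₂ (inj₂ (q≡r , λ p≡q → p≢r (trans p≡q q≡r)))))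

  module _ (_≟ᴬ_ : DecidableEquality A) where

    ¬exactlyTwo-≡₁₃ : p ≡ r → q ≡ p
    ¬exactlyTwo-≡₁₃ p≡r with p ≟ᴬ q
    ... | yes p≡q = sym p≡q
    ... | no p≢q = ⊥-elim (¬two (inj₂ (inj₁ (p≡r , p≢q))))

    ¬exactlyTwo-≡₂₃ : q ≡ r → p ≡ q
    ¬exactlyTwo-≡₂₃ q≡r with p ≟ᴬ q
    ... | yes p≡q = p≡q
    ... | no p≢q = ⊥-elim (¬two (inj₂ (inj₂ (q≡r , p≢q))))

exactlyTwoDistinct? : ∀ {A : Set} → DecidableEquality A → ∀ p q r → Dec (ExactlyTwoDistinct {A} p q r)
exactlyTwoDistinct? _≟ᴬ_ p q r =
          ((p ≟ᴬ q) ×-dec ¬? (q ≟ᴬ r))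
  ⊎-dec ((p ≟ᴬ r) ×-dec ¬? (p ≟ᴬ q))
  ⊎-dec ((q ≟ᴬ r) ×-dec ¬? (p ≟ᴬ q))

module _ {n k : ℕ} (C : EdgeColouring n k) where

  BichromaticAt : Fin n → Set
  BichromaticAt x = Σ[ y ∈ Fin n ] Σ[ z ∈ Fin n ] BichromaticTriangle C x y z

  bichromaticTriangle? : ∀ x y z → Dec (BichromaticTriangle C x y z)
  bichromaticTriangle? x y z =
    ¬? (x ≟ y) ×-dec ¬? (y ≟ z) ×-dec ¬? (x ≟ z) ×-dec
    exactlyTwoDistinct? _≟_ (colour C x y) (colour C y z) (colour C x z)

  bichromaticAt? : ∀ x → Dec (BichromaticAt x)
  bichromaticAt? x = any? λ y → any? λ z → bichromaticTriangle? x y z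

  ¬bichromaticAt⇒¬exactlyTwo : ∀ {x y z} → ¬ BichromaticAt x → x ≢ y → y ≢ z → x ≢ z →
                               ¬ ExactlyTwoDistinct (colour C x y) (colour C y z) (colour C x z)
  ¬bichromaticAt⇒¬exactlyTwo ¬bx x≢y y≢z x≢z two = ¬bx (_ , _ , x≢y , y≢z , x≢z , two)

module PairCode {n k : ℕ} (C : EdgeColouring n k) {a b c : Fin n}
  (a≢b : a ≢ b) (b≢c : b ≢ c) (a≢c : a ≢ c) (α≢β : colour C a b ≢ colour C a c)
  (¬bich-a : ¬ BichromaticAt C a) (¬bich-b : ¬ BichromaticAt C b) (¬bich-c : ¬ BichromaticAt C c)
  where

  private
    col : Fin n → Fin n → Fin k
    col = colour C

    ¬two-a : ∀ {y z} → a ≢ y → y ≢ z → a ≢ z → ¬ ExactlyTwoDistinct (col a y) (col y z) (col a z)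
    ¬two-a = ¬bichromaticAt⇒¬exactlyTwo C ¬bich-a

    ¬two-b : ∀ {y z} → b ≢ y → y ≢ z → b ≢ z → ¬ ExactlyTwoDistinct (col b y) (col y z) (col b z)
    ¬two-b = ¬bichromaticAt⇒¬exactlyTwo C ¬bich-b

    ¬two-c : ∀ {y z} → c ≢ y → y ≢ z → c ≢ z → ¬ ExactlyTwoDistinct (col c y) (col y z) (col c z)
    ¬two-c = ¬bichromaticAt⇒¬exactlyTwo C ¬bich-c

  α β γ : Fin k
  α = col a b
  β = col a c
  γ = col b c

  γ≢α×γ≢β : γ ≢ α × γ ≢ β
  γ≢α×γ≢β = ¬exactlyTwo-rainbow (¬two-a a≢b b≢c a≢c) α≢β

  module Agreeing {v : Fin n} (v≢a : v ≢ a) (v≢b : v ≢ b) (agree : col a v ≡ col b v) where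

    av≡α : col a v ≡ α
    av≡α = trans agree (sym (¬exactlyTwo-≡₂₃ (¬two-a a≢b (≢-sym v≢b) (≢-sym v≢a)) _≟_ (sym agree)))

    v≢c : v ≢ c
    v≢c refl = α≢β (sym av≡α)

    cv≡vc : col c v ≡ col v c
    cv≡vc = symmetric C c v (≢-sym v≢c)

    cv≢α×cv≢β : col c v ≢ α × col c v ≢ β
    cv≢α×cv≢β with vc≢av , vc≢β ← ¬exactlyTwo-rainbow (¬two-a (≢-sym v≢a) v≢c a≢c) (α≢β ∘ trans (sym av≡α))
      = (λ cv≡α → vc≢av (trans (sym cv≡vc) (trans cv≡α (sym av≡α))))
      , vc≢β ∘ trans (sym cv≡vc)

    cv≢γ : col c v ≢ γ
    cv≢γ = proj₂ (¬exactlyTwo-rainbow (¬two-b (≢-sym v≢b) v≢c b≢c) bv≢γ) ∘ trans (sym cv≡vc)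
      where
        bv≢γ : col b v ≢ γ
        bv≢γ bv≡γ = proj₁ γ≢α×γ≢β (trans (sym bv≡γ) (trans (sym agree) av≡α))

  data Special : Fin n → Set where
    is-a : Special a
    is-b : Special b
    agreeing : ∀ {v} → v ≢ a → v ≢ b → col a v ≡ col b v → Special v

  data Class (v : Fin n) : Set where
    special : Special v → Class v
    generic : v ≢ a → v ≢ b → col a v ≢ col b v → Class v

  classify : ∀ v → Class v
  classify v with v ≟ a | v ≟ b | col a v ≟ col b v
  ... | yes refl | _        | _           = special is-a
  ... | no _     | yes refl | _           = special is-b
  ... | no v≢a   | no v≢b   | yes agree   = special (agreeing v≢a v≢b agree)
  ... | no v≢a   | no v≢b   | no disagree = generic v≢a v≢b disagree

  shade : ∀ {v} → Special v → Fin k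
  shade is-a = α
  shade is-b = β
  shade (agreeing {v} _ _ _) = col c v

  shade≢γ : ∀ {v} (s : Special v) → shade s ≢ γ
  shade≢γ is-a = ≢-sym (proj₁ γ≢α×γ≢β)
  shade≢γ is-b = ≢-sym (proj₂ γ≢α×γ≢β)
  shade≢γ (agreeing v≢a v≢b agree) = Agreeing.cv≢γ v≢a v≢b agree

  agreeing-injective : ∀ {v w} → v ≢ w → v ≢ a → v ≢ b → col a v ≡ col b v →
                       w ≢ a → w ≢ b → col a w ≡ col b w → col c v ≢ col c w
  agreeing-injective {v} {w} v≢w v≢a v≢b agree-v w≢a w≢b agree-w cv≡cw =
    proj₁ V.cv≢α×cv≢β (trans (sym vw≡cv) vw≡α)
    where
      module V = Agreeing v≢a v≢b agree-v
      module W = Agreeing w≢a w≢b agree-w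

      vw≡cv : col v w ≡ col c v
      vw≡cv = ¬exactlyTwo-≡₁₃ (¬two-c (≢-sym V.v≢c) v≢w (≢-sym W.v≢c)) _≟_ cv≡cw
      vw≡α : col v w ≡ α
      vw≡α = trans (¬exactlyTwo-≡₁₃ (¬two-a (≢-sym v≢a) v≢w (≢-sym w≢a)) _≟_
                      (trans V.av≡α (sym W.av≡α)))
                   V.av≡α

  shade-injective : ∀ {v w} → v ≢ w → (s : Special v) (t : Special w) → shade s ≢ shade t
  shade-injective v≢w is-a is-a = ⊥-elim (v≢w refl)
  shade-injective v≢w is-b is-b = ⊥-elim (v≢w refl)
  shade-injective _ is-a is-b = α≢β
  shade-injective _ is-b is-a = ≢-sym α≢β
  shade-injective _ is-a (agreeing w≢a w≢b agree) = ≢-sym (proj₁ (Agreeing.cv≢α×cv≢β w≢a w≢b agree))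
  shade-injective _ is-b (agreeing w≢a w≢b agree) = ≢-sym (proj₂ (Agreeing.cv≢α×cv≢β w≢a w≢b agree))
  shade-injective _ (agreeing v≢a v≢b agree) is-a = proj₁ (Agreeing.cv≢α×cv≢β v≢a v≢b agree)
  shade-injective _ (agreeing v≢a v≢b agree) is-b = proj₂ (Agreeing.cv≢α×cv≢β v≢a v≢b agree)
  shade-injective v≢w (agreeing v≢a v≢b agree-v) (agreeing w≢a w≢b agree-w) =
    agreeing-injective v≢w v≢a v≢b agree-v w≢a w≢b agree-w

  generic-injective : ∀ {v w} → v ≢ w → v ≢ a → v ≢ b → w ≢ a → w ≢ b →
                      col a v ≡ col a w → col b v ≡ col b w → col a v ≡ col b v
  generic-injective v≢w v≢a v≢b w≢a w≢b av≡aw bv≡bw =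
    trans (sym (¬exactlyTwo-≡₁₃ (¬two-a (≢-sym v≢a) v≢w (≢-sym w≢a)) _≟_ av≡aw))
          (¬exactlyTwo-≡₁₃ (¬two-b (≢-sym v≢b) v≢w (≢-sym w≢b)) _≟_ bv≡bw)

  pair : ∀ {v} → Class v → Fin k × Fin k
  pair (special s) = shade s , shade s
  pair {v} (generic _ _ _) = col a v , col b v

  pair-injective : ∀ {v w} → v ≢ w → (cv : Class v) (cw : Class w) → pair cv ≢ pair cw
  pair-injective v≢w (special s) (special t) = shade-injective v≢w s t ∘ ,-injectiveˡ
  pair-injective _ (special s) (generic _ _ disagree) e =
    disagree (trans (sym (,-injectiveˡ e)) (,-injectiveʳ e))
  pair-injective _ (generic _ _ disagree) (special t) e =
    disagree (trans (,-injectiveˡ e) (sym (,-injectiveʳ e)))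
  pair-injective v≢w (generic v≢a v≢b disagree) (generic w≢a w≢b _) e =
    disagree (generic-injective v≢w v≢a v≢b w≢a w≢b (,-injectiveˡ e) (,-injectiveʳ e))

  pair≢γγ : ∀ {v} (cv : Class v) → pair cv ≢ (γ , γ)
  pair≢γγ (special s) = shade≢γ s ∘ ,-injectiveˡ
  pair≢γγ (generic _ _ disagree) e = disagree (trans (,-injectiveˡ e) (sym (,-injectiveʳ e)))

  code : Fin n → Fin k × Fin k
  code v = pair (classify v)

  code-injective : ∀ {v w} → v ≢ w → code v ≢ code w
  code-injective v≢w = pair-injective v≢w (classify _) (classify _)

  code≢γγ : ∀ v → code v ≢ (γ , γ)
  code≢γγ v = pair≢γγ (classify v)

proposition5 : (N : ℕ) → NonZero N →
    (a b c : Fin (N * N)) → a ≢ b → b ≢ c → a ≢ c →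
    (C : EdgeColouring (N * N) N) →
    colour C a b ≢ colour C a c →
    Σ[ x ∈ Fin (N * N) ] Σ[ y ∈ Fin (N * N) ] Σ[ z ∈ Fin (N * N) ]
      (BichromaticTriangle C x y z × Meets a b c x y z)
proposition5 _ _ a b c a≢b b≢c a≢c C α≢β
  with bichromaticAt? C a | bichromaticAt? C b | bichromaticAt? C c
... | yes (y , z , t) | _ | _ = a , y , z , t , a , inj₁ refl , inj₁ refl
... | no _ | yes (y , z , t) | _ = b , y , z , t , b , inj₂ (inj₁ refl) , inj₁ refl
... | no _ | no _ | yes (y , z , t) = c , y , z , t , c , inj₂ (inj₂ refl) , inj₁ refl
... | no ¬bich-a | no ¬bich-b | no ¬bich-c =
  ⊥-elim (injection-cannot-avoid code code-injective (γ , γ) code≢γγ)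
  where open PairCode C a≢b b≢c a≢c α≢β ¬bich-a ¬bich-b ¬bich-c
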